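{- Let $n,d,s,r\in\mathbb{N}$ with $d^s\mid n$ and $(r,d^s)_s=1$. Let $A=\{r+td^s : t=1,2,\ldots,n/d^s\}$. Then the number of elements $x\in A$ with $(x,n)_s=1$ is $\dfrac{\Phi_s(n)}{\Phi_s(d^s)}$.
   Context: $\mathbb{N}$ denotes the positive integers. For a positive integer $s$ and integers $a,b$ not both zero, $(a,b)_s$ denotes the largest $l^s$ with $l\in\mathbb{N}$ dividing both $a$ and $b$ (the generalized gcd; for $s=1$ it is the usual gcd); for several arguments $(a_1,\ldots,a_m)_s$ is the largest $l^s$ dividing all of them. Klee's function $\Phi_s(n)$, for $s,n\in\mathbb{N}$, is the number of integers $m$ with $1\le m\le n$ and $(m,n)_s=1$; equivalently $\Phi_s(n)=n\prod_{p \text{ prime},\,p^s\mid n}(1-p^{ -s})$. -}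

module Defs where

open import Data.Nat using (ℕ; zero; suc; _+_; _*_; _^_)
open import Data.Nat.Divisibility using (_∣_; _∣?_)
open import Data.Nat.Properties using (_≟_)
open import Data.List using (List; map; filter; length; upTo)
open import Data.Bool using (if_then_else_)
open import Relation.Nullary.Decidable using (_×-dec_; does)

largestBase : ℕ → ℕ → ℕ → ℕ → ℕ
largestBase s a b zero = zero
largestBase s a b (suc l) =
  if does ((suc l ^ s ∣? a) ×-dec (suc l ^ s ∣? b)) then suc l else largestBase s a b l

-- Generalized gcd (a , b)_s : the largest l ^ s (l ∈ ℕ⁺) dividing both a and b.
-- For a , b not both zero, any such l satisfies l ≤ a + b, so searching l ≤ a + b suffices.
gcdₛ : ℕ → ℕ → ℕ → ℕ
gcdₛ s a b = largestBase s a b (a + b) ^ s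

oneTo : ℕ → List ℕ
oneTo n = map suc (upTo n)

Φ : ℕ → ℕ → ℕ
Φ s n = length (filter (λ m → gcdₛ s m n ≟ 1) (oneTo n))

-- Write D = d ^ s and n = m D. Splitting 1, …, n into the residue classes ρ + t D (t < m) modulo D,
-- the class of ρ contains no x with (x , n)_s = 1 unless (ρ , D)_s = 1, and all classes with
-- (ρ , D)_s = 1 contain equally many: if Q is the largest divisor of n coprime to D, then D is
-- invertible modulo Q, so the classes of ρ and r can be matched term by term modulo Q, and
-- (x , n)_s = 1 only depends on x modulo Q once (x , D)_s = 1. Hence Φ_s(n) = Φ_s(D) · #{x ∈ A}.
module Submission where

open import Data.Bool using (if_then_else_)
open import Data.List using (filter; length; applyUpTo)
open import Data.List.Properties using (map-upTo)
open import Data.Nat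
open import Data.Nat.Coprimality as Coprime using (Coprime; coprime?; coprime-divisor; coprime-Bézout)
open import Data.Nat.Divisibility
open import Data.Nat.DivMod using (_/_; m/n*n≡m)
open import Data.Nat.GCD using (gcd; gcd[m,n]∣m; gcd[m,n]∣n; gcd[m,n]≡0⇒n≡0; module Bézout)
open import Data.Nat.LCM using (lcm; m∣lcm[m,n]; n∣lcm[m,n]; lcm-least)
open import Data.Nat.Properties
open import Data.Nat.Tactic.RingSolver using (solve-∀)
open import Data.Product using (_×_; _,_; ∃-syntax; proj₁; proj₂)
open import Data.Sum using (_⊎_; inj₁; inj₂)
open import Function using (_∘_)
open import Relation.Binary.PropositionalEquality
open import Relation.Nullary using (Dec; yes; no; does; ¬_; contradiction)
open import Relation.Nullary.Decidable using (_×-dec_)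
open import Relation.Unary using (Decidable)

open import Defs

∑ : ℕ → (ℕ → ℕ) → ℕ
∑ zero    f = 0
∑ (suc k) f = f 0 + ∑ k (f ∘ suc)

∑-cong : ∀ k {f g : ℕ → ℕ} → (∀ i → f i ≡ g i) → ∑ k f ≡ ∑ k g
∑-cong zero    f≗g = refl
∑-cong (suc k) f≗g = cong₂ _+_ (f≗g 0) (∑-cong k (f≗g ∘ suc))

∑-zero : ∀ k → ∑ k (λ _ → 0) ≡ 0
∑-zero zero    = refl
∑-zero (suc k) = ∑-zero k

∑-split : ∀ a b (f : ℕ → ℕ) → ∑ (a + b) f ≡ ∑ a f + ∑ b (λ i → f (a + i))
∑-split zero    b f = refl
∑-split (suc a) b f = trans (cong (f 0 +_) (∑-split a b (f ∘ suc))) (sym (+-assoc (f 0) _ _))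

∑-+ : ∀ k (f g : ℕ → ℕ) → ∑ k (λ i → f i + g i) ≡ ∑ k f + ∑ k g
∑-+ zero    f g = refl
∑-+ (suc k) f g = trans (cong (f 0 + g 0 +_) (∑-+ k (f ∘ suc) (g ∘ suc))) (+-interchange (f 0) _ _ _)
  where
  +-interchange : ∀ a b c d → a + b + (c + d) ≡ a + c + (b + d)
  +-interchange = solve-∀

∑-*ʳ : ∀ k (f : ℕ → ℕ) c → ∑ k (λ i → f i * c) ≡ ∑ k f * c
∑-*ʳ zero    f c = refl
∑-*ʳ (suc k) f c = trans (cong (f 0 * c +_) (∑-*ʳ k (f ∘ suc) c)) (sym (*-distribʳ-+ c (f 0) _))

∑-last : ∀ k (f : ℕ → ℕ) → ∑ (suc k) f ≡ ∑ k f + f k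
∑-last zero    f = +-identityʳ (f 0)
∑-last (suc k) f = trans (cong (f 0 +_) (∑-last k (f ∘ suc))) (sym (+-assoc (f 0) _ _))

∑-rotate : ∀ k (f : ℕ → ℕ) → f k ≡ f 0 → ∑ k (f ∘ suc) ≡ ∑ k f
∑-rotate k f fk≡f0 = +-cancelʳ-≡ (f 0) _ _ (begin
  ∑ k (f ∘ suc) + f 0  ≡⟨ +-comm (∑ k (f ∘ suc)) (f 0) ⟩
  ∑ (suc k) f          ≡⟨ ∑-last k f ⟩
  ∑ k f + f k          ≡⟨ cong (∑ k f +_) fk≡f0 ⟩
  ∑ k f + f 0          ∎)
  where open ≡-Reasoning

∑-periodic : ∀ k (f : ℕ → ℕ) → (∀ x → f (x + k) ≡ f x) → ∀ c → ∑ k (λ i → f (c + i)) ≡ ∑ k f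
∑-periodic k f periodic zero    = refl
∑-periodic k f periodic (suc c) = begin
  ∑ k (λ i → f (suc c + i))  ≡⟨ ∑-cong k (λ i → cong f (sym (+-suc c i))) ⟩
  ∑ k (λ i → f (c + suc i))  ≡⟨ ∑-rotate k (λ i → f (c + i)) (trans (periodic c) (cong f (sym (+-identityʳ c)))) ⟩
  ∑ k (λ i → f (c + i))      ≡⟨ ∑-periodic k f periodic c ⟩
  ∑ k f                      ∎
  where open ≡-Reasoning

∑-residues : ∀ m D (f : ℕ → ℕ) → ∑ (m * D) f ≡ ∑ D (λ ρ → ∑ m (λ t → f (ρ + t * D)))
∑-residues zero    D f = sym (∑-zero D)
∑-residues (suc m) D f = begin
  ∑ (D + m * D) f                                            ≡⟨ ∑-split D (m * D) f ⟩
  ∑ D f + ∑ (m * D) (λ i → f (D + i))                        ≡⟨ cong (∑ D f +_) (∑-residues m D (λ i → f (D + i))) ⟩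
  ∑ D f + ∑ D (λ ρ → ∑ m (λ t → f (D + (ρ + t * D))))       ≡⟨ cong₂ _+_ (∑-cong D (λ ρ → cong f (sym (+-identityʳ ρ))))
                                                                 (∑-cong D (λ ρ → ∑-cong m (λ t → cong f (+-exchange D ρ (t * D))))) ⟩
  ∑ D (λ ρ → f (ρ + 0)) + ∑ D (λ ρ → ∑ m (λ t → f (ρ + suc t * D)))  ≡⟨ sym (∑-+ D _ _) ⟩
  ∑ D (λ ρ → ∑ (suc m) (λ t → f (ρ + t * D)))              ∎
  where
  open ≡-Reasoning
  +-exchange : ∀ a b c → a + (b + c) ≡ b + (a + c)
  +-exchange = solve-∀

indicator : {P : Set} → Dec P → ℕ
indicator P? = if does P? then 1 else 0

indicator-yes : {P : Set} (P? : Dec P) → P → indicator P? ≡ 1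
indicator-yes (yes _) _ = refl
indicator-yes (no ¬p) p = contradiction p ¬p

indicator-no : {P : Set} (P? : Dec P) → ¬ P → indicator P? ≡ 0
indicator-no (yes p) ¬p = contradiction p ¬p
indicator-no (no _)  _  = refl

indicator-cong : {P R : Set} (P? : Dec P) (R? : Dec R) → (P → R) → (R → P) → indicator P? ≡ indicator R?
indicator-cong (yes _) (yes _) _   _   = refl
indicator-cong (no _)  (no _)  _   _   = refl
indicator-cong (yes p) (no ¬r) p⇒r _   = contradiction (p⇒r p) ¬r
indicator-cong (no ¬p) (yes r) _   r⇒p = contradiction (r⇒p r) ¬p

length-filter-applyUpTo : ∀ {P : ℕ → Set} (P? : Decidable P) f k →
                          length (filter P? (applyUpTo f k)) ≡ ∑ k (λ i → indicator (P? (f i)))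
length-filter-applyUpTo P? f zero = refl
length-filter-applyUpTo P? f (suc k) with P? (f 0)
... | yes _ = cong suc (length-filter-applyUpTo P? (f ∘ suc) k)
... | no _  = length-filter-applyUpTo P? (f ∘ suc) k

length-filter-oneTo : ∀ {P : ℕ → Set} (P? : Decidable P) k →
                      length (filter P? (oneTo k)) ≡ ∑ k (λ i → indicator (P? (suc i)))
length-filter-oneTo P? k =
  trans (cong (length ∘ filter P?) (map-upTo suc k)) (length-filter-applyUpTo P? suc k)

m≤m^n : ∀ m n → .{{NonZero m}} → .{{NonZero n}} → m ≤ m ^ n
m≤m^n m (suc n) = m≤m*n m (m ^ n) {{m^n≢0 m n}}

∣m+n∣n⇒∣m : ∀ {d m n} → d ∣ m + n → d ∣ n → d ∣ m
∣m+n∣n⇒∣m {d} {m} {n} d∣m+n d∣n = ∣m+n∣m⇒∣n (subst (d ∣_) (+-comm m n) d∣m+n) d∣n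

coprime-* : ∀ {a b c} → Coprime a c → Coprime b c → Coprime (a * b) c
coprime-* {a} {b} {c} a⊥c b⊥c {i} (i∣ab , i∣c) = b⊥c (coprime-divisor i⊥a i∣ab , i∣c)
  where
  i⊥a : Coprime i a
  i⊥a (j∣i , j∣a) = a⊥c (j∣a , ∣-trans j∣i i∣c)

coprime-^ˡ : ∀ {a c} k → Coprime a c → Coprime (a ^ k) c
coprime-^ˡ {c = c} zero    a⊥c = Coprime.1-coprimeTo c
coprime-^ˡ         (suc k) a⊥c = coprime-* a⊥c (coprime-^ˡ k a⊥c)

coprime-^ : ∀ {a c} k → Coprime a c → Coprime (a ^ k) (c ^ k)
coprime-^ k a⊥c = Coprime.sym (coprime-^ˡ k (Coprime.sym (coprime-^ˡ k a⊥c)))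

coprime-∣ˡ : ∀ {a b c} → a ∣ b → Coprime b c → Coprime a c
coprime-∣ˡ a∣b b⊥c (i∣a , i∣c) = b⊥c (∣-trans i∣a a∣b , i∣c)

^-pres-∣ : ∀ {a b} k → a ∣ b → a ^ k ∣ b ^ k
^-pres-∣ zero    _   = ∣-refl
^-pres-∣ (suc k) a∣b = *-pres-∣ a∣b (^-pres-∣ k a∣b)

greatest : {P : ℕ → Set} → Decidable P → ℕ → ℕ
greatest P? zero    = zero
greatest P? (suc l) = if does (P? (suc l)) then suc l else greatest P? l

greatest-maximal : ∀ {P : ℕ → Set} (P? : Decidable P) B {l} → P l → 1 ≤ l → l ≤ B → l ≤ greatest P? B
greatest-maximal P? zero    p 1≤l l≤0 = contradiction l≤0 (<⇒≱ 1≤l)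
greatest-maximal P? (suc B) {l} p 1≤l l≤1+B with P? (suc B) | m≤n⇒m<n∨m≡n l≤1+B
... | yes _  | _              = l≤1+B
... | no _   | inj₁ (s≤s l≤B) = greatest-maximal P? B p 1≤l l≤B
... | no ¬p  | inj₂ refl      = contradiction p ¬p

greatest≡0⊎satisfies : ∀ {P : ℕ → Set} (P? : Decidable P) B → greatest P? B ≡ 0 ⊎ P (greatest P? B)
greatest≡0⊎satisfies P? zero = inj₁ refl
greatest≡0⊎satisfies P? (suc B) with P? (suc B)
... | yes p = inj₂ p
... | no _  = greatest≡0⊎satisfies P? B

greatest-positive : ∀ {P : ℕ → Set} (P? : Decidable P) B → P 1 → 1 ≤ B → 1 ≤ greatest P? B
greatest-positive P? B p₁ 1≤B = greatest-maximal P? B p₁ ≤-refl 1≤B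

greatest-satisfies : ∀ {P : ℕ → Set} (P? : Decidable P) B → P 1 → 1 ≤ B → P (greatest P? B)
greatest-satisfies P? B p₁ 1≤B with greatest≡0⊎satisfies P? B
... | inj₁ g≡0 = contradiction g≡0 (≢-nonZero⁻¹ _ {{>-nonZero (greatest-positive P? B p₁ 1≤B)}})
... | inj₂ p   = p

CommonPower : ℕ → ℕ → ℕ → ℕ → Set
CommonPower s a b l = l ^ s ∣ a × l ^ s ∣ b

commonPower? : ∀ s a b → Decidable (CommonPower s a b)
commonPower? s a b l = (l ^ s ∣? a) ×-dec (l ^ s ∣? b)

commonPower-1 : ∀ s a b → CommonPower s a b 1
commonPower-1 s a b rewrite ^-zeroˡ s = 1∣ a , 1∣ b

largestBase≡greatest : ∀ s a b B → largestBase s a b B ≡ greatest (commonPower? s a b) B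
largestBase≡greatest s a b zero    = refl
largestBase≡greatest s a b (suc B) =
  cong (if does (commonPower? s a b (suc B)) then suc B else_) (largestBase≡greatest s a b B)

commonPower⇒≤ : ∀ {s a b l} → .{{NonZero s}} → .{{NonZero b}} → 1 ≤ l → CommonPower s a b l → l ≤ a + b
commonPower⇒≤ {s} {a} {b} {l} 1≤l (_ , lˢ∣b) =
  ≤-trans (m≤m^n l s {{>-nonZero 1≤l}}) (≤-trans (∣⇒≤ lˢ∣b) (m≤n+m b a))

module _ (s a b : ℕ) .{{_ : NonZero s}} .{{_ : NonZero b}} where

  private
    base : ℕ
    base = greatest (commonPower? s a b) (a + b)

    gcdₛ≡base^s : gcdₛ s a b ≡ base ^ s
    gcdₛ≡base^s = cong (_^ s) (largestBase≡greatest s a b (a + b))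

    1≤a+b : 1 ≤ a + b
    1≤a+b = ≤-trans (>-nonZero⁻¹ b) (m≤n+m b a)

    base-common : CommonPower s a b base
    base-common = greatest-satisfies (commonPower? s a b) (a + b) (commonPower-1 s a b) 1≤a+b

    base-positive : 1 ≤ base
    base-positive = greatest-positive (commonPower? s a b) (a + b) (commonPower-1 s a b) 1≤a+b

  gcdₛ≡1⊎commonPower : gcdₛ s a b ≡ 1 ⊎ ∃[ l ] (2 ≤ l × CommonPower s a b l)
  gcdₛ≡1⊎commonPower with base | gcdₛ≡base^s | base-common | base-positive
  ... | 1           | eq | _  | _ = inj₁ (trans eq (^-zeroˡ s))
  ... | suc (suc k) | _  | cp | _ = inj₂ (suc (suc k) , s≤s (s≤s z≤n) , cp)

  gcdₛ≡1⇒¬commonPower : gcdₛ s a b ≡ 1 → ∀ {l} → 2 ≤ l → ¬ CommonPower s a b l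
  gcdₛ≡1⇒¬commonPower gcdₛ≡1 {l} 2≤l cp
    with m^n≡1⇒n≡0∨m≡1 base s (trans (sym gcdₛ≡base^s) gcdₛ≡1)
  ... | inj₁ s≡0    = contradiction s≡0 (≢-nonZero⁻¹ s)
  ... | inj₂ base≡1 = <⇒≱ 2≤l (subst (l ≤_) base≡1 l≤base)
    where
    1≤l : 1 ≤ l
    1≤l = ≤-trans (s≤s z≤n) 2≤l
    l≤base : l ≤ base
    l≤base = greatest-maximal (commonPower? s a b) (a + b) cp 1≤l (commonPower⇒≤ 1≤l cp)

  ¬commonPower⇒gcdₛ≡1 : (∀ {l} → 2 ≤ l → ¬ CommonPower s a b l) → gcdₛ s a b ≡ 1
  ¬commonPower⇒gcdₛ≡1 noCommon with gcdₛ≡1⊎commonPower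
  ... | inj₁ gcdₛ≡1          = gcdₛ≡1
  ... | inj₂ (l , 2≤l , cp) = contradiction cp (noCommon 2≤l)

gcdₛ≡1-transport : ∀ s a b a′ b′ → .{{NonZero s}} → .{{NonZero b}} → .{{NonZero b′}} →
                   (∀ {l} → CommonPower s a′ b′ l → CommonPower s a b l) →
                   gcdₛ s a b ≡ 1 → gcdₛ s a′ b′ ≡ 1
gcdₛ≡1-transport s a b a′ b′ common⇒common gcdₛ≡1 =
  ¬commonPower⇒gcdₛ≡1 s a′ b′ (λ 2≤l → gcdₛ≡1⇒¬commonPower s a b gcdₛ≡1 2≤l ∘ common⇒common)

coprimeIndicator : ℕ → ℕ → ℕ → ℕ
coprimeIndicator s b x = indicator (gcdₛ s x b ≟ 1)

coprimeIndicator-periodic : ∀ s b → .{{NonZero s}} → .{{NonZero b}} →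
                            ∀ x → coprimeIndicator s b (x + b) ≡ coprimeIndicator s b x
coprimeIndicator-periodic s b x = indicator-cong (gcdₛ s (x + b) b ≟ 1) (gcdₛ s x b ≟ 1)
  (gcdₛ≡1-transport s (x + b) b x b (λ (lˢ∣x , lˢ∣b) → ∣m∣n⇒∣m+n lˢ∣x lˢ∣b , lˢ∣b))
  (gcdₛ≡1-transport s x b (x + b) b (λ (lˢ∣x+b , lˢ∣b) → ∣m+n∣n⇒∣m lˢ∣x+b lˢ∣b , lˢ∣b))

Φ≡∑coprimeIndicator : ∀ s b → .{{NonZero s}} → .{{NonZero b}} → Φ s b ≡ ∑ b (coprimeIndicator s b)
Φ≡∑coprimeIndicator s b = trans (length-filter-oneTo (λ x → gcdₛ s x b ≟ 1) b)
                                (∑-periodic b (coprimeIndicator s b) (coprimeIndicator-periodic s b) 1)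

divisorCoprimeTo? : ∀ D n → Decidable (λ q → q ∣ n × Coprime q D)
divisorCoprimeTo? D n q = (q ∣? n) ×-dec (coprime? q D)

coprimePart : ℕ → ℕ → ℕ
coprimePart D n = greatest (divisorCoprimeTo? D n) n

module _ (D n : ℕ) .{{_ : NonZero n}} where

  private
    1-divisorCoprimeTo : 1 ∣ n × Coprime 1 D
    1-divisorCoprimeTo = 1∣ n , Coprime.1-coprimeTo D

    coprimePart-spec : coprimePart D n ∣ n × Coprime (coprimePart D n) D
    coprimePart-spec = greatest-satisfies (divisorCoprimeTo? D n) n 1-divisorCoprimeTo (>-nonZero⁻¹ n)

  coprimePart-positive : 1 ≤ coprimePart D n
  coprimePart-positive = greatest-positive (divisorCoprimeTo? D n) n 1-divisorCoprimeTo (>-nonZero⁻¹ n)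

  coprimePart∣n : coprimePart D n ∣ n
  coprimePart∣n = proj₁ coprimePart-spec

  coprimePart-coprime : Coprime (coprimePart D n) D
  coprimePart-coprime = proj₂ coprimePart-spec

  ∣coprimePart : ∀ {e} → e ∣ n → Coprime e D → e ∣ coprimePart D n
  ∣coprimePart {e} e∣n e⊥D = subst (e ∣_) L≡Q (n∣lcm[m,n] Q e)
    where
    Q L : ℕ
    Q = coprimePart D n
    L = lcm Q e
    L∣n : L ∣ n
    L∣n = lcm-least coprimePart∣n e∣n
    L⊥D : Coprime L D
    L⊥D = coprime-∣ˡ (lcm-least {Q} {e} (m∣m*n e) (n∣m*n Q)) (coprime-* coprimePart-coprime e⊥D)
    instance
      L≢0 : NonZero L
      L≢0 = ≢-nonZero (λ L≡0 → ≢-nonZero⁻¹ n (0∣⇒≡0 (subst (_∣ n) L≡0 L∣n)))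
    L≡Q : L ≡ Q
    L≡Q = ≤-antisym (greatest-maximal (divisorCoprimeTo? D n) n (L∣n , L⊥D) (>-nonZero⁻¹ L) (∣⇒≤ L∣n))
                    (∣⇒≤ (m∣lcm[m,n] Q e))

infix 4 _≡_mod_
_≡_mod_ : ℕ → ℕ → ℕ → Set
x ≡ y mod q = ∃[ a ] ∃[ b ] x + a * q ≡ y + b * q

≡-mod-sym : ∀ {x y q} → x ≡ y mod q → y ≡ x mod q
≡-mod-sym (a , b , eq) = b , a , sym eq

≡-mod-+ʳ : ∀ {x y q} k → x ≡ y mod q → x + k ≡ y + k mod q
≡-mod-+ʳ {x} {y} {q} k (a , b , eq) = a , b , (begin
  x + k + a * q  ≡⟨ +-swap x k (a * q) ⟩
  x + a * q + k  ≡⟨ cong (_+ k) eq ⟩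
  y + b * q + k  ≡⟨ +-swap y (b * q) k ⟩
  y + k + b * q  ∎)
  where
  open ≡-Reasoning
  +-swap : ∀ u v w → u + v + w ≡ u + w + v
  +-swap = solve-∀

∣-respects-≡-mod : ∀ {e x y q} → e ∣ q → x ≡ y mod q → e ∣ y → e ∣ x
∣-respects-≡-mod {e} e∣q (a , b , eq) e∣y = ∣m+n∣n⇒∣m
  (subst (e ∣_) (sym eq) (∣m∣n⇒∣m+n e∣y (∣-trans e∣q (n∣m*n b))))
  (∣-trans e∣q (n∣m*n a))

inverse-mod : ∀ {D q} → .{{NonZero q}} → Coprime D q → ∃[ u ] u * D ≡ 1 mod q
inverse-mod {D} {suc q} D⊥q with coprime-Bézout D⊥q
... | Bézout.+- x y 1+yq≡xD = x , 0 , y , trans (+-identityʳ (x * D)) (sym 1+yq≡xD)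
-- here x D ≡ -1, so q x D ≡ 1 modulo q + 1
... | Bézout.-+ x y 1+xD≡yq = q * x , 1 , q * y , (begin
  q * x * D + 1 * suc q  ≡⟨ lemma q x D ⟩
  1 + q * (1 + x * D)    ≡⟨ cong (λ z → 1 + q * z) 1+xD≡yq ⟩
  1 + q * (y * suc q)    ≡⟨ cong (1 +_) (sym (*-assoc q y (suc q))) ⟩
  1 + q * y * suc q      ∎)
  where
  open ≡-Reasoning
  lemma : ∀ q x D → q * x * D + 1 * suc q ≡ 1 + q * (1 + x * D)
  lemma = solve-∀

≡-mod-solve : ∀ {D q} → .{{NonZero q}} → Coprime D q → ∀ a b → ∃[ c ] a ≡ b + c * D mod q
≡-mod-solve {D} {suc q} D⊥q a b with inverse-mod D⊥q
... | u , α , β , uD+αq≡1+βq = u * w , b + w * β , w * α , (begin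
  a + (b + w * β) * suc q        ≡⟨ lemma₁ a b q β ⟩
  b + w * (1 + β * suc q)        ≡⟨ cong (λ z → b + w * z) (sym uD+αq≡1+βq) ⟩
  b + w * (u * D + α * suc q)    ≡⟨ lemma₂ b w u D α (suc q) ⟩
  b + u * w * D + w * α * suc q  ∎)
  where
  open ≡-Reasoning
  w : ℕ
  w = a + q * b
  lemma₁ : ∀ a b q β → a + (b + (a + q * b) * β) * suc q ≡ b + (a + q * b) * (1 + β * suc q)
  lemma₁ = solve-∀
  lemma₂ : ∀ b w u D α Q → b + w * (u * D + α * Q) ≡ b + u * w * D + w * α * Q
  lemma₂ = solve-∀

module ResidueClasses (n d s : ℕ) .{{_ : NonZero n}} .{{_ : NonZero d}} .{{_ : NonZero s}}
                      (dˢ∣n : d ^ s ∣ n) where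

  D : ℕ
  D = d ^ s

  instance
    D≢0 : NonZero D
    D≢0 = m^n≢0 d s

  m : ℕ
  m = n / D

  m*D≡n : m * D ≡ n
  m*D≡n = m/n*n≡m dˢ∣n

  Q : ℕ
  Q = coprimePart D n

  instance
    Q≢0 : NonZero Q
    Q≢0 = >-nonZero (coprimePart-positive D n)

  column : ℕ → ℕ
  column ρ = ∑ m (λ t → coprimeIndicator s n (ρ + t * D))

  Φ≡∑column : Φ s n ≡ ∑ D column
  Φ≡∑column = begin
    Φ s n                             ≡⟨ Φ≡∑coprimeIndicator s n ⟩
    ∑ n (coprimeIndicator s n)        ≡⟨ cong (λ k → ∑ k (coprimeIndicator s n)) (sym m*D≡n) ⟩
    ∑ (m * D) (coprimeIndicator s n)  ≡⟨ ∑-residues m D (coprimeIndicator s n) ⟩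
    ∑ D column                        ∎
    where open ≡-Reasoning

  column-shift : ∀ ρ c → ∑ m (λ t → coprimeIndicator s n (ρ + (c + t) * D)) ≡ column ρ
  column-shift ρ = ∑-periodic m (λ t → coprimeIndicator s n (ρ + t * D)) periodic
    where
    +-*-distrib : ∀ ρ t m D → ρ + (t + m) * D ≡ ρ + t * D + m * D
    +-*-distrib = solve-∀
    periodic : ∀ t → coprimeIndicator s n (ρ + (t + m) * D) ≡ coprimeIndicator s n (ρ + t * D)
    periodic t = trans (cong (coprimeIndicator s n) (trans (+-*-distrib ρ t m D) (cong (ρ + t * D +_) m*D≡n)))
                       (coprimeIndicator-periodic s n (ρ + t * D))

  -- If l ^ s divides ρ′ + t′ D and n, then either g = gcd l d ≥ 2 and g ^ s divides both ρ′ and D,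
  -- or l ^ s is coprime to D, so it divides Q and, by the congruence, also ρ + t D.
  gcdₛ≡1-transfer : ∀ ρ t ρ′ t′ → gcdₛ s ρ′ D ≡ 1 → ρ + t * D ≡ ρ′ + t′ * D mod Q →
                    gcdₛ s (ρ + t * D) n ≡ 1 → gcdₛ s (ρ′ + t′ * D) n ≡ 1
  gcdₛ≡1-transfer ρ t ρ′ t′ ρ′⊥D congruent = gcdₛ≡1-transport s (ρ + t * D) n (ρ′ + t′ * D) n common⇒common
    where
    common⇒common : ∀ {l} → CommonPower s (ρ′ + t′ * D) n l → CommonPower s (ρ + t * D) n l
    common⇒common {l} (lˢ∣ρ′+t′D , lˢ∣n) with gcd l d in g≡
    ... | 0           = contradiction (gcd[m,n]≡0⇒n≡0 l g≡) (≢-nonZero⁻¹ d)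
    ... | 1           = ∣-respects-≡-mod lˢ∣Q congruent lˢ∣ρ′+t′D , lˢ∣n
      where
      lˢ∣Q : l ^ s ∣ Q
      lˢ∣Q = ∣coprimePart D n lˢ∣n (coprime-^ s (Coprime.gcd≡1⇒coprime g≡))
    ... | suc (suc k) = contradiction (gˢ∣ρ′ , gˢ∣D) (gcdₛ≡1⇒¬commonPower s ρ′ D ρ′⊥D (s≤s (s≤s z≤n)))
      where
      gˢ∣D : suc (suc k) ^ s ∣ D
      gˢ∣D = ^-pres-∣ s (subst (_∣ d) g≡ (gcd[m,n]∣n l d))
      gˢ∣ρ′ : suc (suc k) ^ s ∣ ρ′
      gˢ∣ρ′ = ∣m+n∣n⇒∣m (∣-trans (^-pres-∣ s (subst (_∣ l) g≡ (gcd[m,n]∣m l d))) lˢ∣ρ′+t′D) (∣-trans gˢ∣D (n∣m*n t′))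

  column-zero : ∀ ρ {l} → 2 ≤ l → CommonPower s ρ D l → column ρ ≡ 0
  column-zero ρ 2≤l (lˢ∣ρ , lˢ∣D) = trans (∑-cong m noneCoprime) (∑-zero m)
    where
    noneCoprime : ∀ t → coprimeIndicator s n (ρ + t * D) ≡ 0
    noneCoprime t = indicator-no (gcdₛ s (ρ + t * D) n ≟ 1) (λ x⊥n → gcdₛ≡1⇒¬commonPower s (ρ + t * D) n x⊥n 2≤l
      (∣m∣n⇒∣m+n lˢ∣ρ (∣-trans lˢ∣D (n∣m*n t)) , ∣-trans lˢ∣D dˢ∣n))

  column-coprime : ∀ ρ ρ′ → gcdₛ s ρ D ≡ 1 → gcdₛ s ρ′ D ≡ 1 → column ρ ≡ column ρ′
  column-coprime ρ ρ′ ρ⊥D ρ′⊥D with ≡-mod-solve (Coprime.sym (coprimePart-coprime D n)) ρ ρ′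
  ... | c , ρ≡ρ′+cD = trans (∑-cong m matched) (column-shift ρ′ c)
    where
    +-*-assoc : ∀ ρ′ c t D → ρ′ + c * D + t * D ≡ ρ′ + (c + t) * D
    +-*-assoc = solve-∀
    congruent : ∀ t → ρ + t * D ≡ ρ′ + (c + t) * D mod Q
    congruent t = subst (λ z → ρ + t * D ≡ z mod Q) (+-*-assoc ρ′ c t D) (≡-mod-+ʳ (t * D) ρ≡ρ′+cD)
    matched : ∀ t → coprimeIndicator s n (ρ + t * D) ≡ coprimeIndicator s n (ρ′ + (c + t) * D)
    matched t = indicator-cong (gcdₛ s (ρ + t * D) n ≟ 1) (gcdₛ s (ρ′ + (c + t) * D) n ≟ 1)
      (gcdₛ≡1-transfer ρ t ρ′ (c + t) ρ′⊥D (congruent t))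
      (gcdₛ≡1-transfer ρ′ (c + t) ρ t ρ⊥D (≡-mod-sym (congruent t)))

  column≡indicator*column : ∀ r → gcdₛ s r D ≡ 1 → ∀ ρ → column ρ ≡ coprimeIndicator s D ρ * column r
  column≡indicator*column r r⊥D ρ with gcdₛ≡1⊎commonPower s ρ D
  ... | inj₁ ρ⊥D = begin
    column ρ                             ≡⟨ column-coprime ρ r ρ⊥D r⊥D ⟩
    column r                             ≡⟨ sym (*-identityˡ (column r)) ⟩
    1 * column r                         ≡⟨ cong (_* column r) (sym (indicator-yes (gcdₛ s ρ D ≟ 1) ρ⊥D)) ⟩
    coprimeIndicator s D ρ * column r    ∎
    where open ≡-Reasoning
  ... | inj₂ (l , 2≤l , common) = trans (column-zero ρ 2≤l common)
    (cong (_* column r) (sym (indicator-no (gcdₛ s ρ D ≟ 1) (λ ρ⊥D → gcdₛ≡1⇒¬commonPower s ρ D ρ⊥D 2≤l common))))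

  count≡column : ∀ r → length (filter (λ t → gcdₛ s (r + t * D) n ≟ 1) (oneTo m)) ≡ column r
  count≡column r = trans (length-filter-oneTo (λ t → gcdₛ s (r + t * D) n ≟ 1) m) (column-shift r 1)

theorem3p1 : (n d s r : ℕ) → .{{_ : NonZero n}} → .{{_ : NonZero d}} → .{{_ : NonZero s}} → .{{_ : NonZero r}}
    → d ^ s ∣ n → gcdₛ s r (d ^ s) ≡ 1
    → length (filter (λ t → gcdₛ s (r + t * d ^ s) n ≟ 1) (oneTo (_/_ n (d ^ s) {{m^n≢0 d s}}))) * Φ s (d ^ s) ≡ Φ s n
theorem3p1 n d s r dˢ∣n r⊥D = begin
  length (filter (λ t → gcdₛ s (r + t * D) n ≟ 1) (oneTo m)) * Φ s D  ≡⟨ cong₂ _*_ (count≡column r) (Φ≡∑coprimeIndicator s D) ⟩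
  column r * ∑ D (coprimeIndicator s D)                              ≡⟨ *-comm (column r) _ ⟩
  ∑ D (coprimeIndicator s D) * column r                              ≡⟨ sym (∑-*ʳ D (coprimeIndicator s D) (column r)) ⟩
  ∑ D (λ ρ → coprimeIndicator s D ρ * column r)                      ≡⟨ sym (∑-cong D (column≡indicator*column r r⊥D)) ⟩
  ∑ D column                                                         ≡⟨ sym Φ≡∑column ⟩
  Φ s n                                                              ∎
  where
  open ≡-Reasoning
  open ResidueClasses n d s dˢ∣n
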